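{- Let $r \geq 3$ and $q \geq \binom{r+1}{2}$ be integers. Then there are infinitely many integers $n$ divisible by $r$ for which there exist a graph $G$ on $n$ vertices with minimum degree $\delta(G) = \left(\frac{1}{2} + \frac{r(r-1)}{4q}\right) n$ and an edge coloring $f: E(G) \to [q]$ such that every $K_r$-tiling of $G$ has discrepancy $0$ with respect to $f$.
   Context: A $K_r$-tiling of $G$ is a collection of vertex-disjoint copies of $K_r$ in $G$ whose vertex sets partition $V(G)$. The discrepancy of a $K_r$-tiling $\mathcal{T}$ with respect to $f$ is the largest $t$ such that some color $c \in [q]$ appears on at least $\frac{e(\mathcal{T})+t}{q}$ of the edges of the copies in $\mathcal{T}$, where $e(\mathcal{T})$ is the total number of such edges. -}

module Defs where

open import Data.Bool using (Bool; true; false; _∧_)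
open import Data.Nat using (ℕ; zero; suc; _+_; _*_; _≤_; _⊔_; _<ᵇ_)
open import Data.Nat.Combinatorics using (_C_)
open import Data.Fin using (Fin; toℕ; _≟_)
open import Data.List using (List; []; _∷_; foldr; map; cartesianProduct)
open import Data.List using (allFin) public
open import Data.Product using (Σ; _×_; _,_; proj₁; proj₂)
open import Data.Integer as ℤ using (ℤ; +_; _-_)
open import Relation.Binary.PropositionalEquality using (_≡_; _≢_)
open import Relation.Nullary.Decidable using (⌊_⌋)

countB : {A : Set} → (A → Bool) → List A → ℕ
countB p [] = 0
countB p (x ∷ xs) with p x
... | true  = suc (countB p xs)
... | false = countB p xs

record Graph (n : ℕ) : Set where
  field
    adj    : Fin n → Fin n → Bool
    sym    : ∀ i j → adj i j ≡ adj j i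
    irrefl : ∀ i → adj i i ≡ false
open Graph public

deg : {n : ℕ} → Graph n → Fin n → ℕ
deg {n} G i = countB (adj G i) (allFin n)

IsMinDegree : {n : ℕ} → Graph n → ℕ → Set
IsMinDegree {n} G d = (∀ v → d ≤ deg G v) × Σ (Fin n) (λ v → deg G v ≡ d)

-- an edge colouring f : E(G) → [q]; given as a symmetric function on
-- vertex pairs, only its values on edges of G are ever used
record EdgeColoring {n : ℕ} (G : Graph n) (q : ℕ) : Set where
  field
    col    : Fin n → Fin n → Fin q
    colSym : ∀ i j → col i j ≡ col j i
open EdgeColoring public

-- a K_r-tiling: a partition of V(G) into k blocks (tiles), each of size
-- exactly r, and each inducing a clique (a copy of K_r) in G
record Tiling {n : ℕ} (G : Graph n) (r : ℕ) : Set where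
  field
    k      : ℕ
    block  : Fin n → Fin k
    size   : ∀ (b : Fin k) → countB (λ v → ⌊ block v ≟ b ⌋) (allFin n) ≡ r
    clique : ∀ i j → i ≢ j → block i ≡ block j → adj G i j ≡ true
open Tiling public

pairs : (n : ℕ) → List (Fin n × Fin n)
pairs n = Data.List.filterᵇ (λ p → toℕ (proj₁ p) <ᵇ toℕ (proj₂ p))
                           (cartesianProduct (allFin n) (allFin n))
  where import Data.List

inTile : {n r : ℕ} {G : Graph n} → Tiling G r → Fin n × Fin n → Bool
inTile T (i , j) = ⌊ block T i ≟ block T j ⌋

eT : {n r : ℕ} {G : Graph n} → Tiling G r → ℕ
eT {n} T = countB (inTile T) (pairs n)

eTcol : {n r q : ℕ} {G : Graph n} → Tiling G r → EdgeColoring G q → Fin q → ℕ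
eTcol {n} T f c =
  countB (λ p → inTile T p ∧ ⌊ col f (proj₁ p) (proj₂ p) ≟ c ⌋) (pairs n)

maxOver : (q : ℕ) → (Fin q → ℕ) → ℕ
maxOver q g = foldr _⊔_ 0 (map g (allFin q))

-- discrepancy: the largest t with some colour c appearing on at least
-- (e(T)+t)/q edges, i.e. t = max_c (q · e_c(T)) - e(T)
discrepancy : {n r q : ℕ} {G : Graph n} → Tiling G r → EdgeColoring G q → ℤ
discrepancy {q = q} T f = + maxOver q (λ c → q * eTcol T f c) - + eT T

{-# OPTIONS --safe #-}
-- In a K_r-tiling of a complete (r+1)-partite graph the r vertices of a tile lie in distinct
-- parts, so a tile misses at most one part.  For parts V_a ≠ V_b this gives, on every tile,
-- (vertices in V_a)·(vertices in V_b) = (vertices in V_a) + (vertices in V_b) − 1, and summing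
-- over all vertices yields r·e(V_a,V_b) + n = r|V_a| + r|V_b| for the number e(V_a,V_b) of tile
-- edges between the two parts; similarly every vertex of V_a lies on exactly r − 1 tile edges.
--
-- Take parts V₁, …, V_r of size s and V₀ of size m·x, split into m = q − C(r,2) classes of size
-- x.  Edges between V_a and V_b (a, b ≥ 1) get one of C(r,2) pair colours, edges at the u-th class
-- of V₀ get the u-th of the remaining m colours.  For x = r·t and s = (q + C(r,2))·t both counts
-- equal x(r − 1) in every tiling, so all q colours are equally frequent and the discrepancy is 0,
-- while the minimum degree is n − |V₀| = r·s.

module Submission where

open import Defs hiding (sym)
open import Data.Bool using (Bool; true; false; T; not; _∧_)
open import Data.Bool.Properties using (∧-assoc; ∧-comm; ∧-zeroʳ; ∧-identityʳ; T-∧)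
open import Data.Fin
  using (Fin; zero; suc; toℕ; fromℕ<; _≟_; _↑ˡ_; _↑ʳ_; splitAt; remQuot; combine; punchIn; punchOut)
import Data.Fin.Properties as Fin
open import Data.Nat
  using (ℕ; zero; suc; _+_; _*_; _∸_; _⊔_; _≤_; _<_; _<ᵇ_; z≤n; s≤s; NonZero; >-nonZero; >-nonZero⁻¹)
open import Data.Nat.Combinatorics using (_C_; nC1≡n; nCk+nC[k+1]≡[n+1]C[k+1])
open import Data.Nat.Divisibility using (_∣_; divides)
open import Data.Nat.Properties hiding (_≟_)
open import Algebra.Properties.Semiring.Sum +-*-semiring
  using (sum; sum-syntax; sum-cong-≗; ∑-distrib-+; ∑-comm; *-distribˡ-sum; *-distribʳ-sum; sum-remove)
open import Data.Product using (Σ; _×_; _,_; proj₁; uncurry)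
open import Data.Sum using (_⊎_; inj₁; inj₂; map₁)
open import Data.Sum.Properties using (≡-dec)
open import Function using (_∘_)
open import Relation.Binary.PropositionalEquality
  using (_≡_; _≢_; refl; sym; trans; cong; cong₂; subst; module ≡-Reasoning)
open import Relation.Nullary using (Dec; yes; no; does; ¬_; ¬?; _×-dec_)
open import Relation.Binary.Definitions using (tri<; tri≈; tri>)
open import Relation.Nullary.Decidable using (⌊_⌋; isYes≗does; dec-true; dec-false; does-⇔)
open import Function.Bundles using (mk⇔; module Equivalence)
open import Relation.Nullary.Negation using (contradiction)
open import Data.Nat.Tactic.RingSolver using (solve)
open import Data.List using ([]; _∷_; _++_; map; tabulate; filterᵇ; cartesianProduct; foldr)
open import Data.List.Properties using (map-tabulate)
open import Data.Integer using (0ℤ)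
import Data.Integer as ℤ
import Data.Integer.Properties as ℤ

-- Iverson brackets and finite sums

[_] : Bool → ℕ
[ true ] = 1
[ false ] = 0

[∧]≡[]*[] : ∀ x y → [ x ∧ y ] ≡ [ x ] * [ y ]
[∧]≡[]*[] true y = sym (+-identityʳ [ y ])
[∧]≡[]*[] false y = refl

[∧]+[∧] : ∀ s {x y z} → [ x ] + [ y ] ≡ [ z ] → [ s ∧ x ] + [ s ∧ y ] ≡ [ s ∧ z ]
[∧]+[∧] true h = h
[∧]+[∧] false h = refl

[∧]-cong : ∀ s {x y} → (T s → x ≡ y) → [ s ∧ x ] ≡ [ s ∧ y ]
[∧]-cong true h = cong [_] (h _)
[∧]-cong false h = refl

[not]+[] : ∀ x → [ not x ] + [ x ] ≡ 1
[not]+[] true = refl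
[not]+[] false = refl

∧-swapʳ : ∀ x y z → (x ∧ y) ∧ z ≡ (x ∧ z) ∧ y
∧-swapʳ true y z = ∧-comm y z
∧-swapʳ false y z = refl

0/1-product : ∀ {x y} → x ≤ 1 → y ≤ 1 → 1 ≤ x + y → x * y + 1 ≡ x + y
0/1-product {0} {1} _ _ _ = refl
0/1-product {1} {0} _ _ _ = refl
0/1-product {1} {1} _ _ _ = refl
0/1-product {0} {0} _ _ ()
0/1-product {suc (suc _)} (s≤s ()) _ _
0/1-product {_} {suc (suc _)} _ (s≤s ()) _

does-sound : ∀ {A : Set} (a? : Dec A) → T (does a?) → A
does-sound (yes a) _ = a

does-≟-sym : ∀ {k} (a b : Fin k) → does (a ≟ b) ≡ does (b ≟ a)
does-≟-sym a b = does-⇔ (mk⇔ sym sym) (a ≟ b) (b ≟ a)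

<ᵇ-true : ∀ {m n} → m < n → (m <ᵇ n) ≡ true
<ᵇ-true {m} {n} = dec-true (m <? n)

<ᵇ-false : ∀ {m n} → ¬ m < n → (m <ᵇ n) ≡ false
<ᵇ-false {m} {n} = dec-false (m <? n)

[<]+[>]≡[≢] : ∀ {k} (a b : Fin k) → [ toℕ a <ᵇ toℕ b ] + [ toℕ b <ᵇ toℕ a ] ≡ [ not (does (a ≟ b)) ]
[<]+[>]≡[≢] a b with Fin.<-cmp a b
... | tri< a<b a≢b b≮a rewrite <ᵇ-true a<b | <ᵇ-false b≮a | dec-false (a ≟ b) a≢b = refl
... | tri≈ a≮b a≡b b≮a rewrite <ᵇ-false a≮b | <ᵇ-false b≮a | dec-true (a ≟ b) a≡b = refl
... | tri> a≮b a≢b b<a rewrite <ᵇ-false a≮b | <ᵇ-true b<a | dec-false (a ≟ b) a≢b = refl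

∑-const : ∀ n c → ∑[ i < n ] c ≡ n * c
∑-const zero c = refl
∑-const (suc n) c = cong (c +_) (∑-const n c)

∑-zero : ∀ n → ∑[ i < n ] 0 ≡ 0
∑-zero n = trans (∑-const n 0) (*-zeroʳ n)

∑-one : ∀ n → ∑[ i < n ] 1 ≡ n
∑-one n = trans (∑-const n 1) (*-identityʳ n)

∑-mono-≤ : ∀ {n} {f g : Fin n → ℕ} → (∀ i → f i ≤ g i) → sum f ≤ sum g
∑-mono-≤ {zero} f≤g = z≤n
∑-mono-≤ {suc n} f≤g = +-mono-≤ (f≤g zero) (∑-mono-≤ (f≤g ∘ suc))

term≤∑ : ∀ {n} (g : Fin n → ℕ) i → g i ≤ sum g
term≤∑ g zero = m≤m+n (g zero) _
term≤∑ g (suc i) = ≤-trans (term≤∑ (g ∘ suc) i) (m≤n+m _ (g zero))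

∑-[≟] : ∀ {n} (i : Fin n) → ∑[ j < n ] [ does (i ≟ j) ] ≡ 1
∑-[≟] {suc n} zero = cong suc (∑-zero n)
∑-[≟] {suc n} (suc i) = ∑-[≟] i

∑-[≟]′ : ∀ {n} (i : Fin n) → ∑[ j < n ] [ does (j ≟ i) ] ≡ 1
∑-[≟]′ {n} i = trans (sum-cong-≗ {n} λ j → cong [_] (does-≟-sym j i)) (∑-[≟] i)

∑-[∧≟] : ∀ {q} b (x : Fin q) → ∑[ c < q ] [ b ∧ does (x ≟ c) ] ≡ [ b ]
∑-[∧≟] {q} b x = begin
  ∑[ c < q ] [ b ∧ does (x ≟ c) ]       ≡⟨ sum-cong-≗ {q} (λ c → [∧]≡[]*[] b (does (x ≟ c))) ⟩
  ∑[ c < q ] ([ b ] * [ does (x ≟ c) ]) ≡⟨ *-distribˡ-sum [ b ] (λ c → [ does (x ≟ c) ]) ⟨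
  [ b ] * ∑[ c < q ] [ does (x ≟ c) ]   ≡⟨ cong ([ b ] *_) (∑-[≟] x) ⟩
  [ b ] * 1                             ≡⟨ *-identityʳ [ b ] ⟩
  [ b ]                                 ∎
  where open ≡-Reasoning

∑-[]≤1 : ∀ {n} (b : Fin n → Bool) → (∀ i j → T (b i) → T (b j) → i ≡ j) → ∑[ i < n ] [ b i ] ≤ 1
∑-[]≤1 {zero} b unique = z≤n
∑-[]≤1 {suc n} b unique with b zero in eq
... | false = ∑-[]≤1 (b ∘ suc) (λ i j bi bj → Fin.suc-injective (unique (suc i) (suc j) bi bj))
... | true = ≤-reflexive (cong suc (trans (sum-cong-≗ rest-false) (∑-zero n)))
  where
  rest-false : ∀ i → [ b (suc i) ] ≡ 0
  rest-false i with b (suc i) in eq′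
  ... | false = refl
  ... | true with () ← unique zero (suc i) (subst T (sym eq) _) (subst T (sym eq′) _)

-- That is, sum g ≤ g a + g b + (k − 2), stated without truncated subtraction.
∑-≤-two : ∀ {k} (g : Fin k → ℕ) → (∀ p → g p ≤ 1) → ∀ {a b} → a ≢ b → 2 + sum g ≤ k + (g a + g b)
∑-≤-two {suc zero} g g≤1 {zero} {zero} a≢b = contradiction refl a≢b
∑-≤-two {suc (suc k)} g g≤1 {a} {b} a≢b = begin
  2 + sum g
    ≡⟨ cong (2 +_) (sum-remove {i = a} g) ⟩
  2 + (g a + sum (g ∘ punchIn a))
    ≡⟨ cong (λ z → 2 + (g a + z)) (sum-remove {i = b′} (g ∘ punchIn a)) ⟩
  2 + (g a + (g (punchIn a b′) + sum rest))
    ≡⟨ cong (λ z → 2 + (g a + (g z + sum rest))) (Fin.punchIn-punchOut a≢b) ⟩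
  2 + (g a + (g b + sum rest))
    ≤⟨ +-monoʳ-≤ 2 (+-monoʳ-≤ (g a) (+-monoʳ-≤ (g b) rest≤k)) ⟩
  2 + (g a + (g b + k))
    ≡⟨ arrange (g a) (g b) k ⟩
  suc (suc k) + (g a + g b) ∎
  where
  open ≤-Reasoning
  b′ : Fin (suc k)
  b′ = punchOut a≢b
  rest : Fin k → ℕ
  rest = g ∘ punchIn a ∘ punchIn b′
  rest≤k : sum rest ≤ k
  rest≤k = ≤-trans (∑-mono-≤ (g≤1 ∘ punchIn a ∘ punchIn b′)) (≤-reflexive (∑-one k))
  arrange : ∀ x y k → 2 + (x + (y + k)) ≡ suc (suc k) + (x + y)
  arrange x y k = solve (x ∷ y ∷ k ∷ [])

∑-splitAt : ∀ m n (g : Fin m ⊎ Fin n → ℕ) →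
  ∑[ v < m + n ] g (splitAt m v) ≡ ∑[ i < m ] g (inj₁ i) + ∑[ j < n ] g (inj₂ j)
∑-splitAt zero n g = refl
∑-splitAt (suc m) n g = trans (cong (g (inj₁ zero) +_) (∑-splitAt m n (g ∘ map₁ suc)))
  (sym (+-assoc (g (inj₁ zero)) _ _))

∑-↑ : ∀ m n (g : Fin (m + n) → ℕ) → sum g ≡ ∑[ i < m ] g (i ↑ˡ n) + ∑[ j < n ] g (m ↑ʳ j)
∑-↑ zero n g = refl
∑-↑ (suc m) n g = trans (cong (g zero +_) (∑-↑ m n (g ∘ suc))) (sym (+-assoc (g zero) _ _))

∑-combine : ∀ m n (g : Fin (m * n) → ℕ) → sum g ≡ ∑[ i < m ] ∑[ j < n ] g (combine i j)
∑-combine zero n g = refl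
∑-combine (suc m) n g =
  trans (∑-↑ n (m * n) g) (cong (∑[ j < n ] g (j ↑ˡ m * n) +_) (∑-combine m n (g ∘ (n ↑ʳ_))))

∑-remQuot : ∀ m n (g : Fin m × Fin n → ℕ) → ∑[ w < m * n ] g (remQuot n w) ≡ ∑[ i < m ] ∑[ j < n ] g (i , j)
∑-remQuot m n g = trans (∑-combine m n (g ∘ remQuot n))
  (sum-cong-≗ λ i → sum-cong-≗ λ j → cong g (Fin.remQuot-combine i j))

∑∑-orient : ∀ {n k} (κ : Fin n → Fin k) (S : Fin n → Fin n → Bool) → (∀ i j → S i j ≡ S j i) →
  2 * ∑[ i < n ] ∑[ j < n ] [ S i j ∧ (toℕ (κ i) <ᵇ toℕ (κ j)) ]
    ≡ ∑[ i < n ] ∑[ j < n ] [ S i j ∧ not (does (κ i ≟ κ j)) ]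
∑∑-orient {n} κ S S-sym = begin
  2 * X                ≡⟨ cong (X +_) (+-identityʳ X) ⟩
  X + X                ≡⟨ cong (X +_) transposed ⟩
  X + X′               ≡⟨ ∑-distrib-+ {n} _ _ ⟨
  ∑[ i < n ] (∑[ j < n ] oriented i j + ∑[ j < n ] reversed i j)
                       ≡⟨ sum-cong-≗ {n} (λ i → ∑-distrib-+ {n} (oriented i) (reversed i)) ⟨
  ∑[ i < n ] ∑[ j < n ] (oriented i j + reversed i j)
                       ≡⟨ sum-cong-≗ {n} (λ i → sum-cong-≗ {n} λ j →
                            [∧]+[∧] (S i j) ([<]+[>]≡[≢] (κ i) (κ j))) ⟩
  ∑[ i < n ] ∑[ j < n ] [ S i j ∧ not (does (κ i ≟ κ j)) ] ∎
  where
  open ≡-Reasoning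
  oriented reversed : Fin n → Fin n → ℕ
  oriented i j = [ S i j ∧ (toℕ (κ i) <ᵇ toℕ (κ j)) ]
  reversed i j = [ S i j ∧ (toℕ (κ j) <ᵇ toℕ (κ i)) ]
  X X′ : ℕ
  X = ∑[ i < n ] ∑[ j < n ] oriented i j
  X′ = ∑[ i < n ] ∑[ j < n ] reversed i j
  transposed : X ≡ X′
  transposed = trans (∑-comm oriented)
    (sum-cong-≗ {n} λ j → sum-cong-≗ {n} λ i → cong (λ s → [ s ∧ _ ]) (S-sym i j))

-- Counting the edges of a tiling

module _ {A : Set} (p : A → Bool) where

  countB-++ : ∀ xs ys → countB p (xs ++ ys) ≡ countB p xs + countB p ys
  countB-++ [] ys = refl
  countB-++ (x ∷ xs) ys with p x
  ... | true = cong suc (countB-++ xs ys)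
  ... | false = countB-++ xs ys

  countB-filterᵇ : ∀ (q : A → Bool) xs → countB p (filterᵇ q xs) ≡ countB (λ x → p x ∧ q x) xs
  countB-filterᵇ q [] = refl
  countB-filterᵇ q (x ∷ xs) with q x
  ... | false rewrite ∧-zeroʳ (p x) = countB-filterᵇ q xs
  ... | true with p x
  ...   | true = cong suc (countB-filterᵇ q xs)
  ...   | false = countB-filterᵇ q xs

  countB-tabulate : ∀ {n} (f : Fin n → A) → countB p (tabulate f) ≡ ∑[ i < n ] [ p (f i) ]
  countB-tabulate {zero} f = refl
  countB-tabulate {suc n} f with p (f zero)
  ... | true = cong suc (countB-tabulate (f ∘ suc))
  ... | false = countB-tabulate (f ∘ suc)

countB-map : ∀ {A B : Set} (p : B → Bool) (f : A → B) xs → countB p (map f xs) ≡ countB (p ∘ f) xs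
countB-map p f [] = refl
countB-map p f (x ∷ xs) with p (f x)
... | true = cong suc (countB-map p f xs)
... | false = countB-map p f xs

countB-cartesianProduct : ∀ {A B : Set} (p : A × B → Bool) {n} (f : Fin n → A) ys →
  countB p (cartesianProduct (tabulate f) ys) ≡ ∑[ i < n ] countB (λ y → p (f i , y)) ys
countB-cartesianProduct p {zero} f ys = refl
countB-cartesianProduct p {suc n} f ys = begin
  countB p (map (f zero ,_) ys ++ cartesianProduct (tabulate (f ∘ suc)) ys)
    ≡⟨ countB-++ p (map (f zero ,_) ys) _ ⟩
  countB p (map (f zero ,_) ys) + countB p (cartesianProduct (tabulate (f ∘ suc)) ys)
    ≡⟨ cong₂ _+_ (countB-map p (f zero ,_) ys) (countB-cartesianProduct p (f ∘ suc) ys) ⟩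
  ∑[ i < suc n ] countB (λ y → p (f i , y)) ys ∎
  where open ≡-Reasoning

countB-pairs : ∀ {n} (p : Fin n × Fin n → Bool) →
  countB p (pairs n) ≡ ∑[ i < n ] ∑[ j < n ] [ p (i , j) ∧ (toℕ i <ᵇ toℕ j) ]
countB-pairs {n} p = begin
  countB p (pairs n)
    ≡⟨ countB-filterᵇ p _ (cartesianProduct (allFin n) (allFin n)) ⟩
  countB (λ (i , j) → p (i , j) ∧ (toℕ i <ᵇ toℕ j)) (cartesianProduct (allFin n) (allFin n))
    ≡⟨ countB-cartesianProduct _ {n} (λ i → i) (allFin n) ⟩
  ∑[ i < n ] countB (λ j → p (i , j) ∧ (toℕ i <ᵇ toℕ j)) (allFin n)
    ≡⟨ sum-cong-≗ {n} (λ i → countB-tabulate _ {n} (λ j → j)) ⟩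
  ∑[ i < n ] ∑[ j < n ] [ p (i , j) ∧ (toℕ i <ᵇ toℕ j) ] ∎
  where open ≡-Reasoning

eT≡∑eTcol : ∀ {n r q} {G : Graph n} (𝒯 : Tiling G r) (f : EdgeColoring G q) → eT 𝒯 ≡ ∑[ c < q ] eTcol 𝒯 f c
eT≡∑eTcol {n} {q = q} 𝒯 f = begin
  eT 𝒯
    ≡⟨ countB-pairs (inTile 𝒯) ⟩
  ∑[ i < n ] ∑[ j < n ] [ t i j ∧ o i j ]
    ≡⟨ sum-cong-≗ {n} (λ i → sum-cong-≗ {n} (oneColour i)) ⟨
  ∑[ i < n ] ∑[ j < n ] ∑[ c < q ] [ (t i j ∧ ⌊ col f i j ≟ c ⌋) ∧ o i j ]
    ≡⟨ sum-cong-≗ {n} (λ i → ∑-comm {q} {n} _) ⟨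
  ∑[ i < n ] ∑[ c < q ] ∑[ j < n ] [ (t i j ∧ ⌊ col f i j ≟ c ⌋) ∧ o i j ]
    ≡⟨ ∑-comm {q} {n} _ ⟨
  ∑[ c < q ] ∑[ i < n ] ∑[ j < n ] [ (t i j ∧ ⌊ col f i j ≟ c ⌋) ∧ o i j ]
    ≡⟨ sum-cong-≗ {q} (λ c → countB-pairs {n} _) ⟨
  ∑[ c < q ] eTcol 𝒯 f c ∎
  where
  open ≡-Reasoning
  o t : Fin n → Fin n → Bool
  o i j = toℕ i <ᵇ toℕ j
  t i j = inTile 𝒯 (i , j)
  oneColour : ∀ i j → ∑[ c < q ] [ (t i j ∧ ⌊ col f i j ≟ c ⌋) ∧ o i j ] ≡ [ t i j ∧ o i j ]
  oneColour i j = trans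
    (sum-cong-≗ {q} λ c → cong [_] (trans (∧-swapʳ (t i j) _ (o i j)) (cong (_ ∧_) (isYes≗does (col f i j ≟ c)))))
    (∑-[∧≟] (t i j ∧ o i j) (col f i j))

maxOver-const : ∀ q .{{_ : NonZero q}} (g : Fin q → ℕ) {v} → (∀ c → g c ≡ v) → maxOver q g ≡ v
maxOver-const q g {v} g≡v = trans (cong (foldr _⊔_ 0) (map-tabulate (λ c → c) g)) (foldr-⊔ q g g≡v)
  where
  foldr-⊔ : ∀ q .{{_ : NonZero q}} (g : Fin q → ℕ) → (∀ c → g c ≡ v) → foldr _⊔_ 0 (tabulate g) ≡ v
  foldr-⊔ 1 g g≡v = trans (⊔-identityʳ (g zero)) (g≡v zero)
  foldr-⊔ (suc (suc q)) g g≡v =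
    trans (cong₂ _⊔_ (g≡v zero) (foldr-⊔ (suc q) (g ∘ suc) (g≡v ∘ suc))) (⊔-idem v)

discrepancy-zero : ∀ {n r q} .{{_ : NonZero q}} {G : Graph n} (𝒯 : Tiling G r) (f : EdgeColoring G q) {E} →
  (∀ c → eTcol 𝒯 f c ≡ E) → discrepancy 𝒯 f ≡ 0ℤ
discrepancy-zero {q = q} 𝒯 f {E} all≡E = begin
  ℤ.+ maxOver q (λ c → q * eTcol 𝒯 f c) ℤ.- ℤ.+ eT 𝒯
    ≡⟨ cong₂ (λ a b → ℤ.+ a ℤ.- ℤ.+ b) (maxOver-const q _ (λ c → cong (q *_) (all≡E c))) eT≡qE ⟩
  ℤ.+ (q * E) ℤ.- ℤ.+ (q * E)
    ≡⟨ ℤ.+-inverseʳ (ℤ.+ (q * E)) ⟩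
  0ℤ ∎
  where
  open ≡-Reasoning
  eT≡qE : eT 𝒯 ≡ q * E
  eT≡qE = trans (eT≡∑eTcol 𝒯 f) (trans (sum-cong-≗ {q} all≡E) (∑-const q E))

-- Tilings of complete multipartite graphs

module _ {n k} (τ : Fin n → Fin k) where

  completeMultipartite : Graph n
  completeMultipartite = record
    { adj = λ v w → not (does (τ v ≟ τ w))
    ; sym = λ v w → cong not (does-≟-sym (τ v) (τ w))
    ; irrefl = λ v → cong not (dec-true (τ v ≟ τ v) refl)
    }

  partSize : Fin k → ℕ
  partSize p = ∑[ w < n ] [ does (τ w ≟ p) ]

  deg-completeMultipartite : ∀ v → deg completeMultipartite v + partSize (τ v) ≡ n
  deg-completeMultipartite v = begin
    deg completeMultipartite v + partSize (τ v)
      ≡⟨ cong₂ _+_ (countB-tabulate _ {n} (λ w → w))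
                   (sum-cong-≗ {n} λ w → cong [_] (does-≟-sym (τ w) (τ v))) ⟩
    ∑[ w < n ] [ not (does (τ v ≟ τ w)) ] + ∑[ w < n ] [ does (τ v ≟ τ w) ]
      ≡⟨ ∑-distrib-+ {n} _ _ ⟨
    ∑[ w < n ] ([ not (does (τ v ≟ τ w)) ] + [ does (τ v ≟ τ w) ])
      ≡⟨ sum-cong-≗ {n} (λ w → [not]+[] (does (τ v ≟ τ w))) ⟩
    ∑[ w < n ] 1
      ≡⟨ ∑-one n ⟩
    n ∎
    where open ≡-Reasoning

module MultipartiteTiling {n r} (τ : Fin n → Fin (suc r)) (𝒯 : Tiling (completeMultipartite τ) r) where

  sameTile : Fin n → Fin n → Bool
  sameTile i j = does (block 𝒯 i ≟ block 𝒯 j)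

  sameTile-sym : ∀ i j → sameTile i j ≡ sameTile j i
  sameTile-sym i j = does-≟-sym (block 𝒯 i) (block 𝒯 j)

  sameTile-trans : ∀ {i j} l → T (sameTile i j) → sameTile i l ≡ sameTile j l
  sameTile-trans l ij = cong (λ b → does (b ≟ block 𝒯 l)) (does-sound (block 𝒯 _ ≟ _) ij)

  tileSize : ∀ i → ∑[ j < n ] [ sameTile j i ] ≡ r
  tileSize i = trans (sum-cong-≗ {n} λ j → cong [_] (sym (isYes≗does (block 𝒯 j ≟ block 𝒯 i))))
    (trans (sym (countB-tabulate _ {n} (λ j → j))) (size 𝒯 (block 𝒯 i)))

  transversal : ∀ {i j} → T (sameTile i j) → τ i ≡ τ j → i ≡ j
  transversal {i} {j} ij τi≡τj with i ≟ j
  ... | yes i≡j = i≡j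
  ... | no i≢j with () ← trans (sym (clique 𝒯 i j i≢j (does-sound (block 𝒯 i ≟ block 𝒯 j) ij)))
                                (cong not (dec-true (τ i ≟ τ j) τi≡τj))

  tileCount : Fin n → (Fin n → Bool) → ℕ
  tileCount i P = ∑[ j < n ] [ sameTile i j ∧ P j ]

  meets : Fin (suc r) → Fin n → ℕ
  meets p i = tileCount i (λ j → does (τ j ≟ p))

  tileCount-invariant : ∀ {i j} → T (sameTile i j) → (P : Fin n → Bool) → tileCount i P ≡ tileCount j P
  tileCount-invariant ij P = sum-cong-≗ {n} λ l → cong (λ s → [ s ∧ P l ]) (sameTile-trans l ij)

  meets-≤1 : ∀ p i → meets p i ≤ 1
  meets-≤1 p i = ∑-[]≤1 _ unique
    where
    unique : ∀ j j′ → T (sameTile i j ∧ does (τ j ≟ p)) → T (sameTile i j′ ∧ does (τ j′ ≟ p)) →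
             j ≡ j′
    unique j j′ h h′ with Equivalence.to T-∧ h | Equivalence.to T-∧ h′
    ... | ij , τj≡p | ij′ , τj′≡p =
      transversal (subst T (sameTile-trans j′ ij) ij′)
                  (trans (does-sound (τ j ≟ p) τj≡p) (sym (does-sound (τ j′ ≟ p) τj′≡p)))

  ∑-meets : ∀ i → ∑[ p < suc r ] meets p i ≡ r
  ∑-meets i = begin
    ∑[ p < suc r ] ∑[ j < n ] [ sameTile i j ∧ does (τ j ≟ p) ]
      ≡⟨ ∑-comm {suc r} {n} (λ p j → [ sameTile i j ∧ does (τ j ≟ p) ]) ⟩
    ∑[ j < n ] ∑[ p < suc r ] [ sameTile i j ∧ does (τ j ≟ p) ]
      ≡⟨ sum-cong-≗ {n} (λ j → ∑-[∧≟] (sameTile i j) (τ j)) ⟩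
    ∑[ j < n ] [ sameTile i j ]
      ≡⟨ sum-cong-≗ {n} (λ j → cong [_] (sameTile-sym i j)) ⟩
    ∑[ j < n ] [ sameTile j i ]
      ≡⟨ tileSize i ⟩
    r ∎
    where open ≡-Reasoning

  meets-cover : ∀ i {a b} → a ≢ b → 1 ≤ meets a i + meets b i
  meets-cover i {a} {b} a≢b = +-cancelˡ-≤ r 1 (meets a i + meets b i) (≤-pred (begin
    suc (r + 1)                      ≡⟨ cong suc (+-comm r 1) ⟩
    2 + r                            ≡⟨ cong (2 +_) (∑-meets i) ⟨
    2 + ∑[ p < suc r ] meets p i     ≤⟨ ∑-≤-two (λ p → meets p i) (λ p → meets-≤1 p i) a≢b ⟩
    suc r + (meets a i + meets b i)  ∎))
    where open ≤-Reasoning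

  meets-self : ∀ i → meets (τ i) i ≡ 1
  meets-self i = ≤-antisym (meets-≤1 (τ i) i) (subst (_≤ meets (τ i) i) own (term≤∑ _ i))
    where
    own : [ sameTile i i ∧ does (τ i ≟ τ i) ] ≡ 1
    own rewrite dec-true (block 𝒯 i ≟ block 𝒯 i) refl | dec-true (τ i ≟ τ i) refl = refl

  tileCount-otherParts : ∀ i → tileCount i (λ j → not (does (τ j ≟ τ i))) + 1 ≡ r
  tileCount-otherParts i = begin
    tileCount i (λ j → not (does (τ j ≟ τ i))) + 1
      ≡⟨ cong (tileCount i _ +_) (meets-self i) ⟨
    tileCount i (λ j → not (does (τ j ≟ τ i))) + meets (τ i) i
      ≡⟨ ∑-distrib-+ {n} _ _ ⟨
    ∑[ j < n ] ([ sameTile i j ∧ not (does (τ j ≟ τ i)) ] + [ sameTile i j ∧ does (τ j ≟ τ i) ])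
      ≡⟨ sum-cong-≗ {n} (λ j → trans ([∧]+[∧] (sameTile i j) ([not]+[] (does (τ j ≟ τ i))))
                                      (cong [_] (trans (∧-identityʳ (sameTile i j)) (sameTile-sym i j)))) ⟩
    ∑[ j < n ] [ sameTile j i ]
      ≡⟨ tileSize i ⟩
    r ∎
    where open ≡-Reasoning

  tileCount-average : (h : Fin n → ℕ) → (∀ {i j} → T (sameTile i j) → h i ≡ h j) → (P : Fin n → Bool) →
    ∑[ i < n ] (h i * tileCount i P) ≡ r * ∑[ j < n ] ([ P j ] * h j)
  tileCount-average h h-invariant P = begin
    ∑[ i < n ] (h i * ∑[ j < n ] [ sameTile i j ∧ P j ])
      ≡⟨ sum-cong-≗ {n} (λ i → *-distribˡ-sum (h i) (λ j → [ sameTile i j ∧ P j ])) ⟩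
    ∑[ i < n ] ∑[ j < n ] (h i * [ sameTile i j ∧ P j ])
      ≡⟨ sum-cong-≗ {n} (λ i → sum-cong-≗ {n} (move i)) ⟩
    ∑[ i < n ] ∑[ j < n ] (h j * [ sameTile i j ∧ P j ])
      ≡⟨ ∑-comm {n} {n} (λ i j → h j * [ sameTile i j ∧ P j ]) ⟩
    ∑[ j < n ] ∑[ i < n ] (h j * [ sameTile i j ∧ P j ])
      ≡⟨ sum-cong-≗ {n} (λ j → trans (sym (*-distribˡ-sum (h j) (λ i → [ sameTile i j ∧ P j ])))
                                      (cong (h j *_) (column j))) ⟩
    ∑[ j < n ] (h j * ([ P j ] * r))
      ≡⟨ sum-cong-≗ {n} (λ j → rearrange (h j) [ P j ] r) ⟩
    ∑[ j < n ] (r * ([ P j ] * h j))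
      ≡⟨ *-distribˡ-sum r (λ j → [ P j ] * h j) ⟨
    r * ∑[ j < n ] ([ P j ] * h j) ∎
    where
    open ≡-Reasoning
    move : ∀ i j → h i * [ sameTile i j ∧ P j ] ≡ h j * [ sameTile i j ∧ P j ]
    move i j with sameTile i j in ij
    ... | true = cong (_* [ P j ]) (h-invariant (subst T (sym ij) _))
    ... | false = trans (*-zeroʳ (h i)) (sym (*-zeroʳ (h j)))
    column : ∀ j → ∑[ i < n ] [ sameTile i j ∧ P j ] ≡ [ P j ] * r
    column j = begin
      ∑[ i < n ] [ sameTile i j ∧ P j ]
        ≡⟨ sum-cong-≗ {n} (λ i → trans ([∧]≡[]*[] _ (P j)) (*-comm [ sameTile i j ] [ P j ])) ⟩
      ∑[ i < n ] ([ P j ] * [ sameTile i j ])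
        ≡⟨ *-distribˡ-sum [ P j ] (λ i → [ sameTile i j ]) ⟨
      [ P j ] * ∑[ i < n ] [ sameTile i j ]
        ≡⟨ cong ([ P j ] *_) (tileSize j) ⟩
      [ P j ] * r ∎
    rearrange : ∀ x y z → x * (y * z) ≡ z * (y * x)
    rearrange x y z = solve (x ∷ y ∷ z ∷ [])

  ∑∑-tileCount : (P Q : Fin n → Bool) →
    ∑[ i < n ] ∑[ j < n ] [ sameTile i j ∧ (P i ∧ Q j) ] ≡ ∑[ i < n ] ([ P i ] * tileCount i Q)
  ∑∑-tileCount P Q = sum-cong-≗ {n} λ i →
    trans (sum-cong-≗ {n} (factor i)) (sym (*-distribˡ-sum [ P i ] (λ j → [ sameTile i j ∧ Q j ])))
    where
    factor : ∀ i j → [ sameTile i j ∧ (P i ∧ Q j) ] ≡ [ P i ] * [ sameTile i j ∧ Q j ]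
    factor i j with P i
    ... | true = sym (+-identityʳ _)
    ... | false = cong [_] (∧-zeroʳ (sameTile i j))

  between : Fin (suc r) → Fin (suc r) → ℕ
  between a b = ∑[ i < n ] ([ does (τ i ≟ a) ] * meets b i)

  ∑-meets-vertices : ∀ p → ∑[ i < n ] meets p i ≡ r * partSize τ p
  ∑-meets-vertices p = begin
    ∑[ i < n ] meets p i             ≡⟨ sum-cong-≗ {n} (λ i → *-identityˡ (meets p i)) ⟨
    ∑[ i < n ] (1 * meets p i)       ≡⟨ tileCount-average (λ _ → 1) (λ _ → refl) _ ⟩
    r * ∑[ j < n ] ([ does (τ j ≟ p) ] * 1) ≡⟨ cong (r *_) (sum-cong-≗ {n} λ j → *-identityʳ _) ⟩
    r * partSize τ p                 ∎
    where open ≡-Reasoning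

  between-identity : ∀ {a b} → a ≢ b → r * between a b + n ≡ r * partSize τ a + r * partSize τ b
  between-identity {a} {b} a≢b = begin
    r * between a b + n
      ≡⟨ cong₂ _+_ (tileCount-average (meets b) (λ ij → tileCount-invariant ij _) _) (∑-one n) ⟨
    ∑[ i < n ] (meets b i * meets a i) + ∑[ i < n ] 1
      ≡⟨ ∑-distrib-+ {n} _ _ ⟨
    ∑[ i < n ] (meets b i * meets a i + 1)
      ≡⟨ sum-cong-≗ {n} (λ i → trans (cong (_+ 1) (*-comm (meets b i) (meets a i)))
                                      (0/1-product (meets-≤1 a i) (meets-≤1 b i) (meets-cover i a≢b))) ⟩
    ∑[ i < n ] (meets a i + meets b i)
      ≡⟨ ∑-distrib-+ {n} _ _ ⟩
    ∑[ i < n ] meets a i + ∑[ i < n ] meets b i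
      ≡⟨ cong₂ _+_ (∑-meets-vertices a) (∑-meets-vertices b) ⟩
    r * partSize τ a + r * partSize τ b ∎
    where open ≡-Reasoning

  -- A tile edge joins two different parts, so it can be counted from its endpoint in the lower part
  -- instead of from its endpoint of lower index.
  eTcol-byParts : ∀ {q} (f : EdgeColoring (completeMultipartite τ) q) c →
    eTcol 𝒯 f c
      ≡ ∑[ i < n ] ∑[ j < n ] [ sameTile i j ∧ (does (col f i j ≟ c) ∧ (toℕ (τ i) <ᵇ toℕ (τ j))) ]
  eTcol-byParts f c = *-cancelˡ-≡ _ _ 2 (begin
    2 * eTcol 𝒯 f c
      ≡⟨ cong (2 *_) (trans (countB-pairs {n} _) (sum-cong-≗ {n} λ i → sum-cong-≗ {n} λ j → cong (λ b → [ b ∧ _ ])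
           (cong₂ _∧_ (isYes≗does (block 𝒯 i ≟ block 𝒯 j)) (isYes≗does (col f i j ≟ c))))) ⟩
    2 * ∑[ i < n ] ∑[ j < n ] [ S i j ∧ (toℕ i <ᵇ toℕ j) ]
      ≡⟨ ∑∑-orient (λ i → i) S S-sym ⟩
    ∑[ i < n ] ∑[ j < n ] [ S i j ∧ not (does (i ≟ j)) ]
      ≡⟨ sum-cong-≗ {n} (λ i → sum-cong-≗ {n} λ j →
           [∧]-cong (S i j) λ Sij → cong not (≟⇔τ≟ (proj₁ (Equivalence.to T-∧ Sij)))) ⟩
    ∑[ i < n ] ∑[ j < n ] [ S i j ∧ not (does (τ i ≟ τ j)) ]
      ≡⟨ ∑∑-orient τ S S-sym ⟨
    2 * ∑[ i < n ] ∑[ j < n ] [ S i j ∧ (toℕ (τ i) <ᵇ toℕ (τ j)) ]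
      ≡⟨ cong (2 *_) (sum-cong-≗ {n} λ i → sum-cong-≗ {n} λ j → cong [_] (∧-assoc (sameTile i j) _ _)) ⟩
    2 * ∑[ i < n ] ∑[ j < n ] [ sameTile i j ∧ (does (col f i j ≟ c) ∧ (toℕ (τ i) <ᵇ toℕ (τ j))) ] ∎)
    where
    open ≡-Reasoning
    S : Fin n → Fin n → Bool
    S i j = sameTile i j ∧ does (col f i j ≟ c)
    S-sym : ∀ i j → S i j ≡ S j i
    S-sym i j = cong₂ _∧_ (sameTile-sym i j) (cong (λ x → does (x ≟ c)) (colSym f i j))
    ≟⇔τ≟ : ∀ {i j} → T (sameTile i j) → does (i ≟ j) ≡ does (τ i ≟ τ j)
    ≟⇔τ≟ ij = does-⇔ (mk⇔ (cong τ) (transversal ij)) (_ ≟ _) (_ ≟ _)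

-- Numbering the pairs of elements of Fin r

-- Equal to r C 2 (choose2≡C2), but Fin (choose2 (suc r)) = Fin (r + choose2 r) splits definitionally.
choose2 : ℕ → ℕ
choose2 zero = 0
choose2 (suc r) = r + choose2 r

choose2≡C2 : ∀ r → choose2 r ≡ r C 2
choose2≡C2 zero = refl
choose2≡C2 (suc r) = trans (cong₂ _+_ (sym (nC1≡n r)) (choose2≡C2 r)) (nCk+nC[k+1]≡[n+1]C[k+1] r 1)

2*choose2 : ∀ r → 2 * choose2 r ≡ r * (r ∸ 1)
2*choose2 zero = refl
2*choose2 (suc zero) = refl
2*choose2 (suc (suc r)) = begin
  2 * (suc r + choose2 (suc r))   ≡⟨ *-distribˡ-+ 2 (suc r) (choose2 (suc r)) ⟩
  2 * suc r + 2 * choose2 (suc r) ≡⟨ cong (2 * suc r +_) (2*choose2 (suc r)) ⟩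
  2 * suc r + suc r * r           ≡⟨ identity r ⟩
  suc (suc r) * suc r             ∎
  where
  open ≡-Reasoning
  identity : ∀ r → 2 * suc r + suc r * r ≡ suc (suc r) * suc r
  identity r = solve (r ∷ [])

↑ˡ≢↑ʳ : ∀ {m n} (i : Fin m) (j : Fin n) → i ↑ˡ n ≢ m ↑ʳ j
↑ˡ≢↑ʳ {m} {n} i j eq
  with () ← trans (sym (Fin.splitAt-↑ˡ m i n)) (trans (cong (splitAt m) eq) (Fin.splitAt-↑ʳ m n j))

pairIndex : ∀ {r} (a b : Fin r) → .(toℕ a < toℕ b) → Fin (choose2 r)
pairIndex {suc r} zero (suc b) _ = b ↑ˡ choose2 r
pairIndex {suc r} (suc a) (suc b) a<b = r ↑ʳ pairIndex a b (≤-pred a<b)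

pairIndex-injective : ∀ {r} {a b a′ b′ : Fin r} (a<b : toℕ a < toℕ b) (a′<b′ : toℕ a′ < toℕ b′) →
  pairIndex a b a<b ≡ pairIndex a′ b′ a′<b′ → a ≡ a′ × b ≡ b′
pairIndex-injective {suc r} {zero} {suc b} {zero} {suc b′} _ _ eq = refl , cong suc (Fin.↑ˡ-injective (choose2 r) b b′ eq)
pairIndex-injective {suc r} {zero} {suc b} {suc a′} {suc b′} _ _ eq = contradiction eq (↑ˡ≢↑ʳ b _)
pairIndex-injective {suc r} {suc a} {suc b} {zero} {suc b′} _ _ eq = contradiction (sym eq) (↑ˡ≢↑ʳ b′ _)
pairIndex-injective {suc r} {suc a} {suc b} {suc a′} {suc b′} (s≤s a<b) (s≤s a′<b′) eq
  with pairIndex-injective a<b a′<b′ (Fin.↑ʳ-injective r _ _ eq)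
... | refl , refl = refl , refl

pairIndex-surjective : ∀ {r} (k : Fin (choose2 r)) →
  Σ (Fin r) λ a → Σ (Fin r) λ b → Σ (toℕ a < toℕ b) λ a<b → pairIndex a b a<b ≡ k
pairIndex-surjective {suc r} k with splitAt r k in eq
... | inj₁ b = zero , suc b , s≤s z≤n , Fin.splitAt⁻¹-↑ˡ eq
... | inj₂ k′ with pairIndex-surjective k′
...   | a , b , a<b , index≡k′ =
  suc a , suc b , s≤s a<b , trans (cong (r ↑ʳ_) index≡k′) (Fin.splitAt⁻¹-↑ʳ eq)

-- The construction

module Construction (r m t : ℕ) .{{_ : NonZero r}} .{{_ : NonZero t}} (r≤m : r ≤ m) where

  B q x s n E : ℕ
  B = choose2 r
  q = B + m
  x = r * t
  s = (q + B) * t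
  n = m * x + r * s
  E = x * (r ∸ 1)

  instance
    m-nonZero : NonZero m
    m-nonZero = >-nonZero (<-≤-trans (>-nonZero⁻¹ r) r≤m)
    q-nonZero : NonZero q
    q-nonZero = >-nonZero (<-≤-trans (>-nonZero⁻¹ m) (m≤n+m m B))

  Label : Set
  Label = Fin m ⊎ Fin r

  label : Fin n → Label
  label v = Data.Sum.map (proj₁ ∘ remQuot x) (proj₁ ∘ remQuot s) (splitAt (m * x) v)

  part : Label → Fin (suc r)
  part (inj₁ _) = zero
  part (inj₂ a) = suc a

  τ : Fin n → Fin (suc r)
  τ = part ∘ label

  ∑-label : (g : Label → ℕ) → ∑[ v < n ] g (label v) ≡ x * ∑[ u < m ] g (inj₁ u) + s * ∑[ a < r ] g (inj₂ a)
  ∑-label g = begin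
    ∑[ v < n ] g (label v)
      ≡⟨ ∑-splitAt (m * x) (r * s) (g ∘ Data.Sum.map (proj₁ ∘ remQuot x) (proj₁ ∘ remQuot s)) ⟩
    ∑[ w < m * x ] g (inj₁ (proj₁ (remQuot x w))) + ∑[ w < r * s ] g (inj₂ (proj₁ (remQuot s w)))
      ≡⟨ cong₂ _+_ (∑-remQuot m x (g ∘ inj₁ ∘ proj₁)) (∑-remQuot r s (g ∘ inj₂ ∘ proj₁)) ⟩
    ∑[ u < m ] ∑[ j < x ] g (inj₁ u) + ∑[ a < r ] ∑[ j < s ] g (inj₂ a)
      ≡⟨ cong₂ _+_ (sum-cong-≗ {m} λ u → ∑-const x _) (sum-cong-≗ {r} λ a → ∑-const s _) ⟩
    ∑[ u < m ] (x * g (inj₁ u)) + ∑[ a < r ] (s * g (inj₂ a))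
      ≡⟨ cong₂ _+_ (*-distribˡ-sum x (g ∘ inj₁)) (*-distribˡ-sum s (g ∘ inj₂)) ⟨
    x * ∑[ u < m ] g (inj₁ u) + s * ∑[ a < r ] g (inj₂ a) ∎
    where open ≡-Reasoning

  G : Graph n
  G = completeMultipartite τ

  partSize-centre : partSize τ zero ≡ m * x
  partSize-centre = begin
    partSize τ zero                        ≡⟨ ∑-label (λ l → [ does (part l ≟ zero) ]) ⟩
    x * ∑[ u < m ] 1 + s * ∑[ a < r ] 0    ≡⟨ cong₂ (λ a b → x * a + s * b) (∑-one m) (∑-zero r) ⟩
    x * m + s * 0                          ≡⟨ cong (x * m +_) (*-zeroʳ s) ⟩
    x * m + 0                              ≡⟨ trans (+-identityʳ (x * m)) (*-comm x m) ⟩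
    m * x                                  ∎
    where open ≡-Reasoning

  partSize-side : ∀ a → partSize τ (suc a) ≡ s
  partSize-side a = begin
    partSize τ (suc a)                                 ≡⟨ ∑-label (λ l → [ does (part l ≟ suc a) ]) ⟩
    x * ∑[ u < m ] 0 + s * ∑[ b < r ] [ does (b ≟ a) ] ≡⟨ cong₂ (λ z w → x * z + s * w) (∑-zero m) (∑-[≟]′ a) ⟩
    x * 0 + s * 1                                      ≡⟨ cong₂ _+_ (*-zeroʳ x) (*-identityʳ s) ⟩
    s                                                  ∎
    where open ≡-Reasoning

  _≟ₗ_ : (l l′ : Label) → Dec (l ≡ l′)
  _≟ₗ_ = ≡-dec _≟_ _≟_

  centreSize : ∀ u → ∑[ v < n ] [ does (label v ≟ₗ inj₁ u) ] ≡ x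
  centreSize u = begin
    ∑[ v < n ] [ does (label v ≟ₗ inj₁ u) ]              ≡⟨ ∑-label (λ l → [ does (l ≟ₗ inj₁ u) ]) ⟩
    x * ∑[ u′ < m ] [ does (u′ ≟ u) ] + s * ∑[ a < r ] 0 ≡⟨ cong₂ (λ z w → x * z + s * w) (∑-[≟]′ u) (∑-zero r) ⟩
    x * 1 + s * 0                                        ≡⟨ cong₂ _+_ (*-identityʳ x) (*-zeroʳ s) ⟩
    x + 0                                                ≡⟨ +-identityʳ x ⟩
    x                                                    ∎
    where open ≡-Reasoning

  s≤m*x : s ≤ m * x
  s≤m*x = begin
    (B + m + B) * t        ≡⟨ cong (_* t) (arrange B m) ⟩
    (m + 2 * B) * t        ≡⟨ cong (λ z → (m + z) * t) (2*choose2 r) ⟩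
    (m + r * (r ∸ 1)) * t  ≤⟨ *-monoˡ-≤ t (+-monoʳ-≤ m (*-monoˡ-≤ (r ∸ 1) r≤m)) ⟩
    (m + m * (r ∸ 1)) * t  ≡⟨ factor m (r ∸ 1) t ⟩
    m * (suc (r ∸ 1) * t)  ≡⟨ cong (λ z → m * (z * t)) (m+[n∸m]≡n (>-nonZero⁻¹ r)) ⟩
    m * x                  ∎
    where
    open ≤-Reasoning
    arrange : ∀ B m → B + m + B ≡ m + 2 * B
    arrange B m = solve (B ∷ m ∷ [])
    factor : ∀ m d t → (m + m * d) * t ≡ m * (suc d * t)
    factor m d t = solve (m ∷ d ∷ t ∷ [])

  partSize≤m*x : ∀ p → partSize τ p ≤ m * x
  partSize≤m*x zero = ≤-reflexive partSize-centre
  partSize≤m*x (suc a) = subst (_≤ m * x) (sym (partSize-side a)) s≤m*x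

  centreVertex : Fin n
  centreVertex = fromℕ< (>-nonZero⁻¹ (m * x) {{m*n≢0 m x {{m-nonZero}} {{m*n≢0 r t}}}}) ↑ˡ r * s

  τ-centreVertex : τ centreVertex ≡ zero
  τ-centreVertex =
    cong (part ∘ Data.Sum.map (proj₁ ∘ remQuot x) (proj₁ ∘ remQuot s)) (Fin.splitAt-↑ˡ (m * x) _ (r * s))

  minDegree : IsMinDegree G (r * s)
  minDegree = atLeast , centreVertex , attained
    where
    atLeast : ∀ v → r * s ≤ deg G v
    atLeast v = +-cancelʳ-≤ (partSize τ (τ v)) (r * s) (deg G v) (begin
      r * s + partSize τ (τ v) ≤⟨ +-monoʳ-≤ (r * s) (partSize≤m*x (τ v)) ⟩
      r * s + m * x            ≡⟨ +-comm (r * s) (m * x) ⟩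
      n                        ≡⟨ deg-completeMultipartite τ v ⟨
      deg G v + partSize τ (τ v) ∎)
      where open ≤-Reasoning
    attained : deg G centreVertex ≡ r * s
    attained = +-cancelʳ-≡ (m * x) _ _ (begin
      deg G centreVertex + m * x                  ≡⟨ cong (λ p → deg G centreVertex + p) partSize-centre ⟨
      deg G centreVertex + partSize τ zero        ≡⟨ cong (λ p → deg G centreVertex + partSize τ p) τ-centreVertex ⟨
      deg G centreVertex + partSize τ (τ centreVertex) ≡⟨ deg-completeMultipartite τ centreVertex ⟩
      n                                           ≡⟨ +-comm (m * x) (r * s) ⟩
      r * s + m * x                               ∎)
      where open ≡-Reasoning

  degree-equation : 4 * q * (r * s) ≡ (2 * q + r * (r ∸ 1)) * n
  degree-equation = trans (identity r m t B) (cong (λ z → (2 * q + z) * n) (2*choose2 r))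
    where
    identity : ∀ r m t B → 4 * (B + m) * (r * ((B + m + B) * t))
                             ≡ (2 * (B + m) + 2 * B) * (m * (r * t) + r * ((B + m + B) * t))
    identity r m t B = solve (r ∷ m ∷ t ∷ B ∷ [])

  r∣n : r ∣ n
  r∣n = divides (m * t + s) (identity r m t s)
    where
    identity : ∀ r m t s → m * (r * t) + r * s ≡ (m * t + s) * r
    identity r m t s = solve (r ∷ m ∷ t ∷ s ∷ [])

  t≤n : t ≤ n
  t≤n = ≤-trans (m≤n*m t r) (≤-trans (m≤n*m x m) (m≤m+n (m * x) (r * s)))

  -- The colour given to pairs inside one part, which are not edges of G.
  junk : Fin q
  junk = B ↑ʳ fromℕ< (>-nonZero⁻¹ m)

  labelColour : Label → Label → Fin q
  labelColour (inj₁ u) (inj₁ _) = junk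
  labelColour (inj₁ u) (inj₂ _) = B ↑ʳ u
  labelColour (inj₂ _) (inj₁ v) = B ↑ʳ v
  labelColour (inj₂ a) (inj₂ b) with Fin.<-cmp a b
  ... | tri< a<b _ _ = pairIndex a b a<b ↑ˡ m
  ... | tri≈ _ _ _   = junk
  ... | tri> _ _ b<a = pairIndex b a b<a ↑ˡ m

  sideColour-< : ∀ {a b} (a<b : toℕ a < toℕ b) → labelColour (inj₂ a) (inj₂ b) ≡ pairIndex a b a<b ↑ˡ m
  sideColour-< {a} {b} a<b with Fin.<-cmp a b
  ... | tri< _ _ _   = refl
  ... | tri≈ a≮b _ _ = contradiction a<b a≮b
  ... | tri> a≮b _ _ = contradiction a<b a≮b

  sideColour-> : ∀ {a b} (a<b : toℕ a < toℕ b) → labelColour (inj₂ b) (inj₂ a) ≡ pairIndex a b a<b ↑ˡ m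
  sideColour-> {a} {b} a<b with Fin.<-cmp b a
  ... | tri< b<a _ _ = contradiction b<a (<⇒≯ a<b)
  ... | tri≈ _ b≡a _ = contradiction (sym b≡a) (<⇒≢ a<b ∘ cong toℕ)
  ... | tri> _ _ _   = refl

  labelColour-sym : ∀ l l′ → labelColour l l′ ≡ labelColour l′ l
  labelColour-sym (inj₁ u) (inj₁ v) = refl
  labelColour-sym (inj₁ u) (inj₂ b) = refl
  labelColour-sym (inj₂ a) (inj₁ v) = refl
  labelColour-sym (inj₂ a) (inj₂ b) with Fin.<-cmp a b
  ... | tri< a<b _ _ = sym (sideColour-> a<b)
  ... | tri> _ _ b<a = sym (sideColour-< b<a)
  ... | tri≈ _ a≡b _ with Fin.<-cmp b a
  ...   | tri< _ b≢a _ = contradiction (sym a≡b) b≢a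
  ...   | tri≈ _ _ _   = refl
  ...   | tri> _ b≢a _ = contradiction (sym a≡b) b≢a

  colouring : EdgeColoring G q
  colouring = record
    { col = λ i j → labelColour (label i) (label j)
    ; colSym = λ i j → labelColour-sym (label i) (label j)
    }

  pairColour→ : ∀ {a b} (a<b : toℕ a < toℕ b) l l′ → labelColour l l′ ≡ pairIndex a b a<b ↑ˡ m →
    toℕ (part l) < toℕ (part l′) → part l ≡ suc a × part l′ ≡ suc b
  pairColour→ a<b (inj₁ _) (inj₂ _) eq _ = contradiction (sym eq) (↑ˡ≢↑ʳ _ _)
  pairColour→ a<b (inj₂ a′) (inj₂ b′) eq (s≤s a′<b′)
    with pairIndex-injective a′<b′ a<b (Fin.↑ˡ-injective m _ _ (trans (sym (sideColour-< a′<b′)) eq))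
  ... | refl , refl = refl , refl

  pairColour← : ∀ {a b} (a<b : toℕ a < toℕ b) l l′ → part l ≡ suc a → part l′ ≡ suc b →
    labelColour l l′ ≡ pairIndex a b a<b ↑ˡ m × toℕ (part l) < toℕ (part l′)
  pairColour← a<b (inj₂ _) (inj₂ _) refl refl = sideColour-< a<b , s≤s a<b

  pairColour-oriented : ∀ {a b} (a<b : toℕ a < toℕ b) l l′ →
    does (labelColour l l′ ≟ pairIndex a b a<b ↑ˡ m) ∧ (toℕ (part l) <ᵇ toℕ (part l′))
      ≡ does (part l ≟ suc a) ∧ does (part l′ ≟ suc b)
  pairColour-oriented {a} {b} a<b l l′ =
    does-⇔ (mk⇔ (uncurry (pairColour→ a<b l l′)) (uncurry (pairColour← a<b l l′)))
      ((labelColour l l′ ≟ pairIndex a b a<b ↑ˡ m) ×-dec (toℕ (part l) <? toℕ (part l′)))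
      ((part l ≟ suc a) ×-dec (part l′ ≟ suc b))

  starColour→ : ∀ u l l′ → labelColour l l′ ≡ B ↑ʳ u → toℕ (part l) < toℕ (part l′) →
    l ≡ inj₁ u × part l′ ≢ zero
  starColour→ u (inj₁ _) (inj₂ _) eq _ = cong inj₁ (Fin.↑ʳ-injective B _ _ eq) , λ ()
  starColour→ u (inj₂ _) (inj₂ _) eq (s≤s a<b) = contradiction (trans (sym (sideColour-< a<b)) eq) (↑ˡ≢↑ʳ _ _)

  starColour← : ∀ u l l′ → l ≡ inj₁ u → part l′ ≢ zero →
    labelColour l l′ ≡ B ↑ʳ u × toℕ (part l) < toℕ (part l′)
  starColour← u _ (inj₁ _) refl p≢0 = contradiction refl p≢0
  starColour← u _ (inj₂ _) refl _ = refl , s≤s z≤n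

  starColour-oriented : ∀ u l l′ →
    does (labelColour l l′ ≟ B ↑ʳ u) ∧ (toℕ (part l) <ᵇ toℕ (part l′))
      ≡ does (l ≟ₗ inj₁ u) ∧ not (does (part l′ ≟ zero))
  starColour-oriented u l l′ =
    does-⇔ (mk⇔ (uncurry (starColour→ u l l′)) (uncurry (starColour← u l l′)))
      ((labelColour l l′ ≟ B ↑ʳ u) ×-dec (toℕ (part l) <? toℕ (part l′)))
      ((l ≟ₗ inj₁ u) ×-dec ¬? (part l′ ≟ zero))

  rE+n≡rs+rs : r * E + n ≡ r * s + r * s
  rE+n≡rs+rs = begin
    r * (r * t * (r ∸ 1)) + n ≡⟨ cong (_+ n) (reassociate r t (r ∸ 1)) ⟩
    r * t * (r * (r ∸ 1)) + n ≡⟨ cong (λ z → r * t * z + n) (2*choose2 r) ⟨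
    r * t * (2 * B) + n       ≡⟨ identity r m t B ⟩
    r * s + r * s             ∎
    where
    open ≡-Reasoning
    reassociate : ∀ r t d → r * (r * t * d) ≡ r * t * (r * d)
    reassociate r t d = solve (r ∷ t ∷ d ∷ [])
    identity : ∀ r m t B → r * t * (2 * B) + (m * (r * t) + r * ((B + m + B) * t))
                             ≡ r * ((B + m + B) * t) + r * ((B + m + B) * t)
    identity r m t B = solve (r ∷ m ∷ t ∷ B ∷ [])

  module _ (𝒯 : Tiling G r) where
    open MultipartiteTiling τ 𝒯

    eTcol-factor : ∀ c (P Q : Label → Bool) →
      (∀ l l′ → does (labelColour l l′ ≟ c) ∧ (toℕ (part l) <ᵇ toℕ (part l′)) ≡ P l ∧ Q l′) →
      eTcol 𝒯 colouring c ≡ ∑[ i < n ] ([ P (label i) ] * tileCount i (Q ∘ label))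
    eTcol-factor c P Q oriented = trans (eTcol-byParts colouring c)
      (trans (sum-cong-≗ {n} λ i → sum-cong-≗ {n} λ j →
                cong (λ b → [ sameTile i j ∧ b ]) (oriented (label i) (label j)))
             (∑∑-tileCount (P ∘ label) (Q ∘ label)))

    eTcol-pairColour : ∀ {a b} (a<b : toℕ a < toℕ b) → eTcol 𝒯 colouring (pairIndex a b a<b ↑ˡ m) ≡ E
    eTcol-pairColour {a} {b} a<b = *-cancelˡ-≡ _ _ r (+-cancelʳ-≡ n _ _ (begin
      r * eTcol 𝒯 colouring (pairIndex a b a<b ↑ˡ m) + n
        ≡⟨ cong (λ z → r * z + n) (eTcol-factor _ (λ l → does (part l ≟ suc a)) (λ l′ → does (part l′ ≟ suc b))
                                                  (pairColour-oriented a<b)) ⟩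
      r * between (suc a) (suc b) + n
        ≡⟨ between-identity (<⇒≢ (s≤s a<b) ∘ cong toℕ) ⟩
      r * partSize τ (suc a) + r * partSize τ (suc b)
        ≡⟨ cong₂ (λ z w → r * z + r * w) (partSize-side a) (partSize-side b) ⟩
      r * s + r * s
        ≡⟨ rE+n≡rs+rs ⟨
      r * E + n ∎))
      where open ≡-Reasoning

    eTcol-starColour : ∀ u → eTcol 𝒯 colouring (B ↑ʳ u) ≡ E
    eTcol-starColour u = begin
      eTcol 𝒯 colouring (B ↑ʳ u)
        ≡⟨ eTcol-factor _ (λ l → does (l ≟ₗ inj₁ u)) (λ l′ → not (does (part l′ ≟ zero)))
                          (starColour-oriented u) ⟩
      ∑[ i < n ] ([ does (label i ≟ₗ inj₁ u) ] * tileCount i (λ j → not (does (τ j ≟ zero))))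
        ≡⟨ sum-cong-≗ {n} centreRow ⟩
      ∑[ i < n ] ([ does (label i ≟ₗ inj₁ u) ] * (r ∸ 1))
        ≡⟨ *-distribʳ-sum (r ∸ 1) (λ i → [ does (label i ≟ₗ inj₁ u) ]) ⟨
      ∑[ i < n ] [ does (label i ≟ₗ inj₁ u) ] * (r ∸ 1)
        ≡⟨ cong (_* (r ∸ 1)) (centreSize u) ⟩
      E ∎
      where
      open ≡-Reasoning
      otherParts : ∀ i → τ i ≡ zero → tileCount i (λ j → not (does (τ j ≟ zero))) ≡ r ∸ 1
      otherParts i τi≡0 = trans (sym (m+n∸n≡m _ 1)) (cong (_∸ 1)
        (subst (λ p → tileCount i (λ j → not (does (τ j ≟ p))) + 1 ≡ r) τi≡0 (tileCount-otherParts i)))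
      centreRow : ∀ i → [ does (label i ≟ₗ inj₁ u) ] * tileCount i (λ j → not (does (τ j ≟ zero)))
                          ≡ [ does (label i ≟ₗ inj₁ u) ] * (r ∸ 1)
      centreRow i with label i ≟ₗ inj₁ u
      ... | no _ = refl
      ... | yes li≡u = cong (1 *_) (otherParts i (cong part li≡u))

    eTcol-balanced : ∀ c → eTcol 𝒯 colouring c ≡ E
    eTcol-balanced c with splitAt B c in eq
    ... | inj₁ k with pairIndex-surjective k
    ...   | a , b , a<b , index≡k =
      subst (λ c → eTcol 𝒯 colouring c ≡ E)
            (trans (cong (_↑ˡ m) index≡k) (Fin.splitAt⁻¹-↑ˡ eq)) (eTcol-pairColour a<b)
    eTcol-balanced c | inj₂ u = subst (λ c → eTcol 𝒯 colouring c ≡ E) (Fin.splitAt⁻¹-↑ʳ eq) (eTcol-starColour u)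

choose2-split : ∀ r q → (r + 1) C 2 ≤ q → Σ ℕ λ m → r ≤ m × choose2 r + m ≡ q
choose2-split r q r+1C2≤q = q ∸ choose2 r , r≤m , m+[n∸m]≡n B≤q
  where
  r+B≤q : r + choose2 r ≤ q
  r+B≤q = subst (_≤ q) (trans (cong (_C 2) (+-comm r 1)) (sym (choose2≡C2 (suc r)))) r+1C2≤q
  B≤q : choose2 r ≤ q
  B≤q = ≤-trans (m≤n+m (choose2 r) r) r+B≤q
  r≤m : r ≤ q ∸ choose2 r
  r≤m = +-cancelʳ-≤ (choose2 r) r (q ∸ choose2 r) (subst (r + choose2 r ≤_) (sym (m∸n+n≡m B≤q)) r+B≤q)

lemma2p5 : (r q : ℕ) → 3 ≤ r → (r + 1) C 2 ≤ q →
    (N : ℕ) → Σ ℕ (λ n → N ≤ n × r ∣ n ×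
      Σ (Graph n) (λ G → Σ ℕ (λ d → IsMinDegree G d × 4 * q * d ≡ (2 * q + r * (r ∸ 1)) * n ×
        Σ (EdgeColoring G q) (λ f → (T : Tiling G r) → discrepancy T f ≡ 0ℤ))))
lemma2p5 r q 3≤r r+1C2≤q N with choose2-split r q r+1C2≤q
... | m , r≤m , refl =
  n , ≤-trans (n≤1+n N) t≤n , r∣n , G , r * s , minDegree , degree-equation , colouring ,
  λ 𝒯 → discrepancy-zero 𝒯 colouring (eTcol-balanced 𝒯)
  where
  instance
    r-nonZero : NonZero r
    r-nonZero = >-nonZero (≤-trans (s≤s z≤n) 3≤r)
  open Construction r m (suc N) r≤m
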